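{- For every $n\ge1$, the map $h$ is a bijection from $\bigcup_{\pi\in S_n}\mathrm{Mad}(\mathrm{LMin}(\pi))$ to $\mathrm{Asc}_n\times S_n$.
   Context: $[a,b]=\{i\in\mathbb Z:a\le i\le b\}$; $S_n$ is the set of permutations of $[1,n]$, written in one-line notation as words. For a sequence $(a_1,\dots,a_i)$ let $\mathrm{asc}(a_1,\dots,a_i)=|\{j\in[1,i-1]:a_j<a_{j+1}\}|$. A sequence $(a_1,\dots,a_m)$ of non-negative integers is an ascent sequence if $a_1=0$ and $a_{i+1}\in[0,1+\mathrm{asc}(a_1,\dots,a_i)]$ for $0<i<m$; $\mathrm{Asc}_m$ is the set of ascent sequences of length $m$. Writing a sequence $\alpha$ uniquely as $m_1$ copies of $c_1$, then $m_2$ copies of $c_2$, \dots, then $m_r$ copies of $c_r$ with $m_j\ge1$ and $c_j\neq c_{j+1}$, its run-length encoding is $\mathrm{RLE}(\alpha)=(c_1,m_1)\cdots(c_r,m_r)$ and its run-length record is $\mathrm{RLR}(\alpha)=(m_1,\dots,m_r)$. For a finite set $Y$ and positive integers $m_1,\dots,m_r$ summing to $|Y|$, $\binom{Y}{m_1,\dots,m_r}$ denotes the set of ordered set partitions $(Y_1,\dots,Y_r)$ of $Y$ with $|Y_j|=m_j$. Define $\mathrm{Mad}(Y)=\bigcup_{\alpha\in\mathrm{Asc}_{|Y|}}\{\alpha\}\times\binom{Y}{\mathrm{RLR}(\alpha)}$. For $\pi=\pi_1\cdots\pi_n\in S_n$, $\pi_j$ is a left-to-right minimum if $\pi_j<\pi_i$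 for all $i<j$; $\mathrm{LMin}(\pi)$ is the set of words (segments) obtained by cutting $\pi$ immediately before each left-to-right minimum, e.g. $\mathrm{LMin}(5731462)=\{57,3,1462\}$. The domain of $h$ is the set of pairs $(\alpha,\chi)$ where, for some $\pi\in S_n$ with $k$ left-to-right minima, $\alpha=(a_1,\dots,a_k)\in\mathrm{Asc}_k$ and $\chi=(X_1,\dots,X_r)\in\binom{\mathrm{LMin}(\pi)}{\mathrm{RLR}(\alpha)}$ (note $\pi$ is determined by $\mathrm{LMin}(\pi)$). Definition of $h(\alpha,\chi)=(\beta,\tau)$: for each $j\in[1,r]$ let $\hat X_j$ be the word obtained by ordering the segments in $X_j$ in decreasing order of their first letters and concatenating them. Let $\tau=\hat X_1\hat X_2\cdots\hat X_r\in S_n$. Let $i_1=1$ and $i_{j+1}=i_j+|X_j|$, so $a_{i_j}$ is the common value of the $j$th run of $\alpha$. Let $\beta$ be the sequence with $\mathrm{RLE}(\beta)=(a_{i_1},\ell_1)(a_{i_2},\ell_2)\cdots(a_{i_r},\ell_r)$, where $\ell_j$ is the length of the word $\hat X_j$; i.e. $\beta$ consists of $\ell_1$ copies of $a_{i_1}$, then $\ell_2$ copies of $a_{i_2}$, etc. -}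

module Defs where

open import Data.Nat using (ℕ; zero; suc; _≤_; _<_; _<ᵇ_; _≡ᵇ_)
open import Data.Nat.Properties using (_≟_)
open import Data.Bool using (Bool; true; false; if_then_else_)
open import Data.List using (List; []; _∷_; [_]; _++_; length; map; concat; replicate; filter; zip; zipWith; upTo; applyUpTo; foldr; lookup)
open import Data.List.Relation.Unary.All using (All)
open import Data.List.Relation.Binary.Permutation.Propositional using (_↭_)
open import Data.Product using (Σ; _×_; _,_; proj₁; proj₂)
open import Data.Unit using (⊤)
open import Relation.Binary.PropositionalEquality using (_≡_)
open import Relation.Nullary.Decidable using (⌊_⌋)

IsPerm : ℕ → List ℕ → Set
IsPerm n π = π ↭ applyUpTo suc n

asc : List ℕ → ℕ
asc [] = 0
asc (x ∷ []) = 0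
asc (x ∷ y ∷ ys) = if x <ᵇ y then suc (asc (y ∷ ys)) else asc (y ∷ ys)

-- ascOK p s xs : the remaining entries xs are admissible, given the previous entry p
-- and s = asc of the prefix read so far (each new entry x must satisfy x ≤ 1 + s).
ascOK : ℕ → ℕ → List ℕ → Set
ascOK p s [] = ⊤
ascOK p s (x ∷ xs) = x ≤ suc s × ascOK x (if p <ᵇ x then suc s else s) xs

IsAsc : List ℕ → Set
IsAsc [] = ⊤
IsAsc (x ∷ xs) = x ≡ 0 × ascOK x 0 xs

RLE : List ℕ → List (ℕ × ℕ)
RLE [] = []
RLE (x ∷ xs) with RLE xs
... | [] = (x , 1) ∷ []
... | (c , m) ∷ rest = if x ≡ᵇ c then (c , suc m) ∷ rest else (x , 1) ∷ (c , m) ∷ rest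

RLR : List ℕ → List ℕ
RLR a = map proj₂ (RLE a)

-- LMin(π): cut π immediately before each left-to-right minimum.
-- lminGo m seg xs : m = current minimum, seg = current (unfinished) segment.
lminGo : ℕ → List ℕ → List ℕ → List (List ℕ)
lminGo m seg [] = seg ∷ []
lminGo m seg (y ∷ ys) = if y <ᵇ m then seg ∷ lminGo y [ y ] ys else lminGo m (seg ++ [ y ]) ys

LMin : List ℕ → List (List ℕ)
LMin [] = []
LMin (x ∷ xs) = lminGo x [ x ] xs

-- Representation of an ordered set partition (Y_0,...,Y_{r-1}) of the segments of π
-- (listed in their order of appearance in π): a list of block labels, the i-th entry
-- being the index j of the block containing the i-th segment.
count : ℕ → List ℕ → ℕ
count j L = length (filter (λ x → x ≟ j) L)

IsOSP : List ℕ → List ℕ → Set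
IsOSP ms L = All (λ x → x < length ms) L × map (λ j → count j L) (upTo (length ms)) ≡ ms

block : List (List ℕ) → List ℕ → ℕ → List (List ℕ)
block segs L j = map proj₁ (filter (λ p → proj₂ p ≟ j) (zip segs L))

headOr0 : List ℕ → ℕ
headOr0 [] = 0
headOr0 (x ∷ _) = x

insertDec : List ℕ → List (List ℕ) → List (List ℕ)
insertDec s [] = s ∷ []
insertDec s (t ∷ ts) = if headOr0 t <ᵇ headOr0 s then s ∷ t ∷ ts else t ∷ insertDec s ts

sortDec : List (List ℕ) → List (List ℕ)
sortDec = foldr insertDec []

hatX : List (List ℕ) → List ℕ → ℕ → List ℕ
hatX segs L j = concat (sortDec (block segs L j))

-- A domain element (π, α, L) : π ∈ S_n, α ∈ Asc_k with k = |LMin π|, L a labelling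
-- encoding χ ∈ binom(LMin π ; RLR α).
InDom : ℕ → List ℕ × List ℕ × List ℕ → Set
InDom n (π , α , L) =
  IsPerm n π × IsAsc α × length α ≡ length (LMin π) × length L ≡ length (LMin π) × IsOSP (RLR α) L

InCod : ℕ → List ℕ × List ℕ → Set
InCod n (β , τ) = IsAsc β × length β ≡ n × IsPerm n τ

h : List ℕ × List ℕ × List ℕ → List ℕ × List ℕ
h (π , α , L) = (β , τ)
  where
    segs = LMin π
    r = length (RLE α)
    τ = concat (map (hatX segs L) (upTo r))
    β = concat (zipWith (λ cm j → replicate (length (hatX segs L j)) (proj₁ cm)) (RLE α) (upTo r))

module Submission where

-- The map h is a bijection because each of the three kinds of data it handles
-- can be recovered from its output.
--
-- * Segments. LMin cuts a word into a chain: nonempty segments led by their least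
--   letter, with strictly decreasing first letters. LMin and concat are inverse
--   bijections between words and chains (concat-LMin, LMin-chain, LMin-concat).
-- * Runs. A sequence is determined by its run-length encoding (expand-RLE,
--   RLE-expand), and being an ascent sequence depends only on the run values, not
--   on the multiplicities (ascent-reRun). So β is α with its run multiplicities
--   |X_j| replaced by the word lengths |X̂_j|.
-- * Blocks. Reading a labelling of a chain as an ordered set partition, every
--   block is again a chain, hence already sorted, so X̂_j is the concatenation of
--   block j (hatX-block); all blocks together rearrange the chain (blocks-↭), and
--   the blocks determine the chain and the labelling (blocks-determine).

open import Defs
open import Data.Nat using (ℕ; zero; suc; _≤_; _<_; _<ᵇ_; _≡ᵇ_; z≤n; s≤s; _+_; _∸_)
import Data.Nat.Properties as ℕ
open import Data.Nat.Properties using (_≟_)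
open import Data.Bool using (true; false; if_then_else_)
open import Data.Bool.Properties using (T-≡; ¬-not)
open import Data.List using (List; []; _∷_; [_]; _++_; length; map; concat; replicate; filter; zip; zipWith; upTo; applyUpTo; foldr; take; drop)
open import Data.Nat.ListAction using (sum)
import Data.List.Properties as List
open import Data.List.Relation.Unary.All using (All; []; _∷_)
import Data.List.Relation.Unary.All as All
import Data.List.Relation.Unary.All.Properties as All
open import Data.List.Relation.Unary.AllPairs using (AllPairs; []; _∷_)
import Data.List.Relation.Unary.AllPairs.Properties as AllPairs
import Data.List.Relation.Unary.Unique.Propositional.Properties as Unique
open import Data.List.Relation.Binary.Permutation.Propositional using (_↭_; ↭-refl; ↭-sym; ↭-trans; prep; swap)
import Data.List.Relation.Binary.Permutation.Propositional as ↭
import Data.List.Relation.Binary.Permutation.Propositional.Properties as ↭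
import Data.List.Relation.Binary.Permutation.Setoid.Properties as ↭ₛ
open import Data.List.Relation.Unary.Any using (here; there)
open import Data.Product using (Σ; _×_; _,_; proj₁; proj₂)
open import Data.Unit using (⊤; tt)
open import Data.Empty using (⊥; ⊥-elim)
open import Function using (_∘_; id)
open import Function.Bundles using (Equivalence; _⇔_; mk⇔)
open import Relation.Nullary using (¬_; yes; no)
open import Relation.Nullary.Decidable using (¬?)
open import Relation.Unary using (Decidable)
open import Relation.Binary.PropositionalEquality using (_≡_; refl; sym; trans; cong; cong₂; subst; _≢_; resp₂; setoid; module ≡-Reasoning)

open Equivalence using (to; from)

true≢false : true ≢ false
true≢false ()

<ᵇ-true : ∀ {x y} → x < y → (x <ᵇ y) ≡ true
<ᵇ-true x<y = to T-≡ (ℕ.<⇒<ᵇ x<y)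

<ᵇ-true⇒ : ∀ {x y} → (x <ᵇ y) ≡ true → x < y
<ᵇ-true⇒ e = ℕ.<ᵇ⇒< _ _ (from T-≡ e)

<ᵇ-false : ∀ {x y} → y ≤ x → (x <ᵇ y) ≡ false
<ᵇ-false y≤x = ¬-not (λ e → ℕ.<⇒≱ (<ᵇ-true⇒ e) y≤x)

<ᵇ-false⇒ : ∀ {x y} → (x <ᵇ y) ≡ false → y ≤ x
<ᵇ-false⇒ e = ℕ.≮⇒≥ (λ x<y → true≢false (trans (sym (<ᵇ-true x<y)) e))

≡ᵇ-refl : ∀ c → (c ≡ᵇ c) ≡ true
≡ᵇ-refl c = to T-≡ (ℕ.≡⇒≡ᵇ c c refl)

≡ᵇ-false : ∀ {x y} → x ≢ y → (x ≡ᵇ y) ≡ false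
≡ᵇ-false x≢y = ¬-not (λ e → x≢y (ℕ.≡ᵇ⇒≡ _ _ (from T-≡ e)))

≡ᵇ-true⇒ : ∀ {x y} → (x ≡ᵇ y) ≡ true → x ≡ y
≡ᵇ-true⇒ e = ℕ.≡ᵇ⇒≡ _ _ (from T-≡ e)

≡ᵇ-false⇒ : ∀ {x y} → (x ≡ᵇ y) ≡ false → x ≢ y
≡ᵇ-false⇒ {x} e refl = true≢false (trans (sym (≡ᵇ-refl x)) e)

concat-↭ : ∀ {A : Set} {xss yss : List (List A)} → xss ↭ yss → concat xss ↭ concat yss
concat-↭ ↭.refl = ↭-refl
concat-↭ (prep xs p) = ↭.++⁺ˡ xs (concat-↭ p)
concat-↭ (swap xs ys p) = ↭-trans (↭.++⁺ˡ xs (↭.++⁺ˡ ys (concat-↭ p))) (↭.shifts xs ys)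
concat-↭ (↭.trans p q) = ↭-trans (concat-↭ p) (concat-↭ q)

AllPairs-resp-↭ : ∀ {A : Set} {R : A → A → Set} → (∀ {x y} → R x y → R y x) →
  ∀ {xs ys} → xs ↭ ys → AllPairs R xs → AllPairs R ys
AllPairs-resp-↭ {R = R} R-sym p = ↭ₛ.AllPairs-resp-↭ (setoid _) R-sym (resp₂ R) (↭.↭⇒↭ₛ p)

AllPairs-++ʳ : ∀ {A : Set} {R : A → A → Set} xs {ys} → AllPairs R (xs ++ ys) → AllPairs R ys
AllPairs-++ʳ [] a = a
AllPairs-++ʳ (x ∷ xs) (_ ∷ a) = AllPairs-++ʳ xs a

length-concat : ∀ {A : Set} (xss : List (List A)) → length (concat xss) ≡ sum (map length xss)
length-concat [] = refl
length-concat (xs ∷ xss) = trans (List.length-++ xs) (cong (length xs +_) (length-concat xss))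

concat-injective : ∀ {A : Set} (xss yss : List (List A)) → map length xss ≡ map length yss →
  concat xss ≡ concat yss → xss ≡ yss
concat-injective [] [] _ _ = refl
concat-injective (xs ∷ xss) (ys ∷ yss) lengths e =
  cong₂ _∷_ (proj₁ pieces) (concat-injective xss yss (List.∷-injectiveʳ lengths) (proj₂ pieces))
  where
  prefix : ∀ {A : Set} (x y a b : List A) → length x ≡ length y → x ++ a ≡ y ++ b → x ≡ y × a ≡ b
  prefix [] [] a b _ e = refl , e
  prefix (u ∷ x) (v ∷ y) a b l e with refl ← List.∷-injectiveˡ e =
    let (x≡y , a≡b) = prefix x y a b (ℕ.suc-injective l) (List.∷-injectiveʳ e) in cong (u ∷_) x≡y , a≡b
  pieces : xs ≡ ys × concat xss ≡ concat yss
  pieces = prefix xs ys (concat xss) (concat yss) (List.∷-injectiveˡ lengths) e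

module _ {A B : Set} where
  unzip-injective : (R S : List (A × B)) → map proj₁ R ≡ map proj₁ S → map proj₂ R ≡ map proj₂ S → R ≡ S
  unzip-injective [] [] _ _ = refl
  unzip-injective ((a , b) ∷ R) ((a' , b') ∷ S) e₁ e₂
    with refl ← List.∷-injectiveˡ e₁ | refl ← List.∷-injectiveˡ e₂ =
    cong ((a , b) ∷_) (unzip-injective R S (List.∷-injectiveʳ e₁) (List.∷-injectiveʳ e₂))

  zip-unzip : (R : List (A × B)) → zip (map proj₁ R) (map proj₂ R) ≡ R
  zip-unzip [] = refl
  zip-unzip (x ∷ R) = cong (x ∷_) (zip-unzip R)

  map-proj₁-zip : (as : List A) (bs : List B) → length as ≡ length bs → map proj₁ (zip as bs) ≡ as
  map-proj₁-zip [] [] _ = refl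
  map-proj₁-zip (a ∷ as) (b ∷ bs) e = cong (a ∷_) (map-proj₁-zip as bs (ℕ.suc-injective e))

  map-proj₂-zip : (as : List A) (bs : List B) → length as ≡ length bs → map proj₂ (zip as bs) ≡ bs
  map-proj₂-zip [] [] _ = refl
  map-proj₂-zip (a ∷ as) (b ∷ bs) e = cong (b ∷_) (map-proj₂-zip as bs (ℕ.suc-injective e))

  All-zip₂ : {Q : B → Set} (as : List A) (bs : List B) → All Q bs → All (Q ∘ proj₂) (zip as bs)
  All-zip₂ [] bs _ = []
  All-zip₂ (a ∷ as) [] _ = []
  All-zip₂ (a ∷ as) (b ∷ bs) (q ∷ qs) = q ∷ All-zip₂ as bs qs

module _ {A : Set} {P : A → Set} (P? : Decidable P) where
  partition-↭ : ∀ xs → filter P? xs ++ filter (¬? ∘ P?) xs ↭ xs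
  partition-↭ [] = ↭-refl
  partition-↭ (x ∷ xs) with P? x
  ... | yes _ = prep x (partition-↭ xs)
  ... | no _ = ↭-trans (↭.shift x (filter P? xs) (filter (¬? ∘ P?) xs)) (prep x (partition-↭ xs))

  All-filter-¬ : ∀ {Q : A → Set} {xs} → All Q xs → All (λ x → Q x × ¬ P x) (filter (¬? ∘ P?) xs)
  All-filter-¬ {xs = []} [] = []
  All-filter-¬ {xs = x ∷ xs} (q ∷ qs) with P? x
  ... | yes _ = All-filter-¬ qs
  ... | no ¬p = (q , ¬p) ∷ All-filter-¬ qs

module _ {A : Set} {P Q : A → Set} (P? : Decidable P) (Q? : Decidable Q) where
  filter-filter-weaker : (∀ {x} → P x → Q x) → ∀ xs → filter P? (filter Q? xs) ≡ filter P? xs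
  filter-filter-weaker P⇒Q [] = refl
  filter-filter-weaker P⇒Q (x ∷ xs) with Q? x | P? x
  ... | yes q | yes p = trans (List.filter-accept P? p) (cong (x ∷_) (filter-filter-weaker P⇒Q xs))
  ... | yes q | no ¬p = trans (List.filter-reject P? ¬p) (filter-filter-weaker P⇒Q xs)
  ... | no ¬q | yes p = ⊥-elim (¬q (P⇒Q p))
  ... | no ¬q | no ¬p = filter-filter-weaker P⇒Q xs

-- Chains: the lists of segments produced by LMin, and their inverse concat.

LedByMin : List ℕ → Set
LedByMin [] = ⊥
LedByMin (x ∷ t) = All (x ≤_) t

Descends : List ℕ → List ℕ → Set
Descends s t = headOr0 t < headOr0 s

Chain : List (List ℕ) → Set
Chain S = AllPairs Descends S × All LedByMin S

concat-lminGo : ∀ m seg xs → concat (lminGo m seg xs) ≡ seg ++ xs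
concat-lminGo m seg [] = refl
concat-lminGo m seg (y ∷ ys) with y <ᵇ m
... | true = cong (seg ++_) (concat-lminGo y [ y ] ys)
... | false = trans (concat-lminGo m (seg ++ [ y ]) ys) (List.++-assoc seg [ y ] ys)

concat-LMin : ∀ π → concat (LMin π) ≡ π
concat-LMin [] = refl
concat-LMin (x ∷ xs) = concat-lminGo x [ x ] xs

lminGo-chain : ∀ x t xs → All (x ≤_) t →
  Chain (lminGo x (x ∷ t) xs) × All (λ s → headOr0 s ≤ x) (lminGo x (x ∷ t) xs)
lminGo-chain x t [] x≤t = ([] ∷ [] , x≤t ∷ []) , ℕ.≤-refl ∷ []
lminGo-chain x t (y ∷ ys) x≤t with y <ᵇ x in eq
... | false = lminGo-chain x (t ++ [ y ]) ys (All.++⁺ x≤t (<ᵇ-false⇒ eq ∷ []))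
... | true =
  let ((desc , led) , heads≤y) = lminGo-chain y [] ys []
      y<x = <ᵇ-true⇒ eq
  in (All.map (λ h≤y → ℕ.≤-<-trans h≤y y<x) heads≤y ∷ desc , x≤t ∷ led)
     , ℕ.≤-refl ∷ All.map (λ h≤y → ℕ.≤-trans h≤y (ℕ.<⇒≤ y<x)) heads≤y

LMin-chain : ∀ π → Chain (LMin π)
LMin-chain [] = [] , []
LMin-chain (x ∷ xs) = proj₁ (lminGo-chain x [] xs [])

lminGo-absorb : ∀ x seg t ys → All (x ≤_) t → lminGo x seg (t ++ ys) ≡ lminGo x (seg ++ t) ys
lminGo-absorb x seg [] ys [] = cong (λ s → lminGo x s ys) (sym (List.++-identityʳ seg))
lminGo-absorb x seg (y ∷ t) ys (x≤y ∷ x≤t) rewrite <ᵇ-false x≤y =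
  trans (lminGo-absorb x (seg ++ [ y ]) t ys x≤t) (cong (λ s → lminGo x s ys) (List.++-assoc seg [ y ] t))

lminGo-concat : ∀ m seg S → All (λ s → headOr0 s < m) S → Chain S → lminGo m seg (concat S) ≡ seg ∷ S
lminGo-concat m seg [] _ _ = refl
lminGo-concat m seg ((x ∷ t) ∷ S) (x<m ∷ _) (desc ∷ descs , x≤t ∷ leds) rewrite <ᵇ-true x<m =
  cong (seg ∷_) (trans (lminGo-absorb x [ x ] t (concat S) x≤t) (lminGo-concat x (x ∷ t) S desc (descs , leds)))

LMin-concat : ∀ S → Chain S → LMin (concat S) ≡ S
LMin-concat [] _ = refl
LMin-concat ((x ∷ t) ∷ S) (desc ∷ descs , x≤t ∷ leds) =
  trans (lminGo-absorb x [ x ] t (concat S) x≤t) (lminGo-concat x (x ∷ t) S desc (descs , leds))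

LMin-nonempty : ∀ w → 1 ≤ length w → 1 ≤ length (LMin w)
LMin-nonempty (x ∷ xs) _ = go x [ x ] xs
  where
  go : ∀ m seg ys → 1 ≤ length (lminGo m seg ys)
  go m seg [] = s≤s z≤n
  go m seg (y ∷ ys) with y <ᵇ m
  ... | true = s≤s z≤n
  ... | false = go m (seg ++ [ y ]) ys

heads-distinct : ∀ S → AllPairs _≢_ (concat S) → All LedByMin S → AllPairs (λ s t → headOr0 s ≢ headOr0 t) S
heads-distinct [] _ _ = []
heads-distinct ((x ∷ t) ∷ S) (x≢ ∷ distinct) (_ ∷ leds) =
  heads-of S (All.++⁻ʳ t x≢) leds ∷ heads-distinct S (AllPairs-++ʳ t distinct) leds
  where
  heads-of : ∀ {Q : ℕ → Set} S → All Q (concat S) → All LedByMin S → All (Q ∘ headOr0) S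
  heads-of [] _ _ = []
  heads-of ((y ∷ u) ∷ S) (q ∷ qs) (_ ∷ leds) = q ∷ heads-of S (All.++⁻ʳ u qs) leds

-- Run-length encodings, and the dependence of ascent sequences on their runs.

expand : List (ℕ × ℕ) → List ℕ
expand [] = []
expand ((c , m) ∷ R) = replicate m c ++ expand R

expand-RLE : ∀ a → expand (RLE a) ≡ a
expand-RLE [] = refl
expand-RLE (x ∷ xs) with RLE xs | expand-RLE xs
... | [] | e = cong (x ∷_) e
... | (c , m) ∷ rest | e with x ≡ᵇ c in eq
... | true = cong₂ _∷_ (sym (≡ᵇ-true⇒ eq)) e
... | false = cong (x ∷_) e

length-expand : ∀ R → length (expand R) ≡ sum (map proj₂ R)
length-expand [] = refl
length-expand ((c , m) ∷ R) =
  trans (List.length-++ (replicate m c)) (cong₂ _+_ (List.length-replicate m) (length-expand R))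

DiffersFromNext : ℕ → List (ℕ × ℕ) → Set
DiffersFromNext c [] = ⊤
DiffersFromNext c ((c' , _) ∷ _) = c ≢ c'

Runs : List (ℕ × ℕ) → Set
Runs [] = ⊤
Runs ((c , m) ∷ R) = 1 ≤ m × DiffersFromNext c R × Runs R

Runs-RLE : ∀ a → Runs (RLE a)
Runs-RLE [] = tt
Runs-RLE (x ∷ xs) with RLE xs | Runs-RLE xs
... | [] | _ = s≤s z≤n , tt , tt
... | (c , m) ∷ rest | (m>0 , differs , runs) with x ≡ᵇ c in eq
... | true = s≤s z≤n , differs , runs
... | false = s≤s z≤n , ≡ᵇ-false⇒ eq , m>0 , differs , runs

Runs⇒positive : ∀ R → Runs R → All (λ cm → 1 ≤ proj₂ cm) R
Runs⇒positive [] _ = []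
Runs⇒positive ((c , m) ∷ R) (m>0 , _ , runs) = m>0 ∷ Runs⇒positive R runs

RLE-expand : ∀ R → Runs R → RLE (expand R) ≡ R
RLE-expand [] _ = refl
RLE-expand ((c , suc k) ∷ R) (_ , differs , runs) = RLE-run c k R differs (RLE-expand R runs)
  where
  RLE-run : ∀ c k R → DiffersFromNext c R → RLE (expand R) ≡ R →
    RLE (replicate (suc k) c ++ expand R) ≡ (c , suc k) ∷ R
  RLE-run c zero [] _ _ = refl
  RLE-run c zero ((c' , m) ∷ R) c≢c' e rewrite e | ≡ᵇ-false c≢c' = refl
  RLE-run c (suc k) R differs e rewrite RLE-run c k R differs e | ≡ᵇ-refl c = refl

reRun : List (ℕ × ℕ) → List ℕ → List (ℕ × ℕ)
reRun R ms = zip (map proj₁ R) ms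

Runs-reRun : ∀ R ms → Runs R → All (1 ≤_) ms → Runs (reRun R ms)
Runs-reRun [] ms _ _ = tt
Runs-reRun (_ ∷ R) [] _ _ = tt
Runs-reRun ((c , m) ∷ []) (ℓ ∷ ms) _ (ℓ>0 ∷ _) = ℓ>0 , tt , tt
Runs-reRun ((c , m) ∷ _ ∷ R) (ℓ ∷ []) _ (ℓ>0 ∷ _) = ℓ>0 , tt , tt
Runs-reRun ((c , m) ∷ cm' ∷ R) (ℓ ∷ ℓ' ∷ ms) (_ , differs , runs) (ℓ>0 ∷ ms>0) =
  ℓ>0 , differs , Runs-reRun (cm' ∷ R) (ℓ' ∷ ms) runs ms>0

values-reRun : ∀ R ms → length ms ≡ length R → map proj₁ (reRun R ms) ≡ map proj₁ R
values-reRun R ms e = map-proj₁-zip (map proj₁ R) ms (trans (List.length-map proj₁ R) (sym e))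

mults-reRun : ∀ R ms → length ms ≡ length R → map proj₂ (reRun R ms) ≡ ms
mults-reRun R ms e = map-proj₂-zip (map proj₁ R) ms (trans (List.length-map proj₁ R) (sym e))

concat-replicate-expand : ∀ (R : List (ℕ × ℕ)) js (f : ℕ → ℕ) →
  concat (zipWith (λ cm j → replicate (f j) (proj₁ cm)) R js) ≡ expand (reRun R (map f js))
concat-replicate-expand [] js f = refl
concat-replicate-expand (cm ∷ R) [] f = refl
concat-replicate-expand (cm ∷ R) (j ∷ js) f = cong (replicate (f j) (proj₁ cm) ++_) (concat-replicate-expand R js f)

-- Repeating the previous value neither creates an ascent nor violates the bound.
ascOK-repeat : ∀ c s k xs → c ≤ suc s → ascOK c s (replicate k c ++ xs) ⇔ ascOK c s xs
ascOK-repeat c s zero xs _ = mk⇔ (λ a → a) (λ a → a)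
ascOK-repeat c s (suc k) xs c≤ rewrite <ᵇ-false (ℕ.≤-refl {c}) =
  let ih = ascOK-repeat c s k xs c≤ in mk⇔ (to ih ∘ proj₂) (λ a → c≤ , from ih a)

ascOK-expand : ∀ p s R → All (λ cm → 1 ≤ proj₂ cm) R → ascOK p s (expand R) ⇔ ascOK p s (map proj₁ R)
ascOK-expand p s [] _ = mk⇔ (λ a → a) (λ a → a)
ascOK-expand p s ((c , suc k) ∷ R) (_ ∷ pos) =
  mk⇔ (λ (c≤ , a) → c≤ , to ih (to (repeat c≤) a)) (λ (c≤ , a) → c≤ , from (repeat c≤) (from ih a))
  where
  s' : ℕ
  s' = if p <ᵇ c then suc s else s
  s≤s' : s ≤ s'
  s≤s' with p <ᵇ c
  ... | true = ℕ.n≤1+n s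
  ... | false = ℕ.≤-refl
  ih : ascOK c s' (expand R) ⇔ ascOK c s' (map proj₁ R)
  ih = ascOK-expand c s' R pos
  repeat : c ≤ suc s → ascOK c s' (replicate k c ++ expand R) ⇔ ascOK c s' (expand R)
  repeat c≤ = ascOK-repeat c s' k (expand R) (ℕ.≤-trans c≤ (s≤s s≤s'))

IsAsc-expand : ∀ R → All (λ cm → 1 ≤ proj₂ cm) R → IsAsc (expand R) ⇔ IsAsc (map proj₁ R)
IsAsc-expand [] _ = mk⇔ (λ a → a) (λ a → a)
IsAsc-expand ((c , suc k) ∷ R) (_ ∷ pos) =
  mk⇔ (λ (c≡0 , a) → c≡0 , to (after c≡0) a) (λ (c≡0 , a) → c≡0 , from (after c≡0) a)
  where
  after : c ≡ 0 → ascOK c 0 (replicate k c ++ expand R) ⇔ ascOK c 0 (map proj₁ R)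
  after refl = mk⇔ (to (ascOK-expand 0 0 R pos) ∘ to (ascOK-repeat 0 0 k (expand R) z≤n))
                   (from (ascOK-repeat 0 0 k (expand R) z≤n) ∘ from (ascOK-expand 0 0 R pos))

ascent-reRun : ∀ R ms → Runs R → All (1 ≤_) ms → length ms ≡ length R →
  IsAsc (expand R) → IsAsc (expand (reRun R ms))
ascent-reRun R ms runs ms>0 e asc =
  from (IsAsc-expand (reRun R ms) (Runs⇒positive _ (Runs-reRun R ms runs ms>0)))
    (subst IsAsc (sym (values-reRun R ms e)) (to (IsAsc-expand R (Runs⇒positive R runs)) asc))

range : ℕ → ℕ → List ℕ
range k zero = []
range k (suc n) = k ∷ range (suc k) n

upTo-range : ∀ n → upTo n ≡ range 0 n
upTo-range n = trans (shifted id n) (List.map-id (range 0 n))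
  where
  range-suc : ∀ k n → range (suc k) n ≡ map suc (range k n)
  range-suc k zero = refl
  range-suc k (suc n) = cong (suc k ∷_) (range-suc (suc k) n)
  shifted : ∀ {A : Set} (f : ℕ → A) n → applyUpTo f n ≡ map f (range 0 n)
  shifted f zero = refl
  shifted f (suc n) = cong (f 0 ∷_) (begin
    applyUpTo (f ∘ suc) n            ≡⟨ shifted (f ∘ suc) n ⟩
    map (f ∘ suc) (range 0 n)        ≡⟨ List.map-∘ (range 0 n) ⟩
    map f (map suc (range 0 n))      ≡⟨ cong (map f) (range-suc 0 n) ⟨
    map f (range 1 n)                ∎)
    where open ≡-Reasoning

range-bounds : ∀ k n → All (λ j → k ≤ j × j < k + n) (range k n)
range-bounds k zero = []
range-bounds k (suc n) = (ℕ.≤-refl , ℕ.m<m+n k (s≤s z≤n)) ∷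
  All.map (λ {j} (k<j , j<) → ℕ.<⇒≤ k<j , subst (j <_) (sym (ℕ.+-suc k n)) j<) (range-bounds (suc k) n)

map-range-pointwise : ∀ {A : Set} (f g : ℕ → A) k n → map f (range k n) ≡ map g (range k n) →
  ∀ j → k ≤ j → j < k + n → f j ≡ g j
map-range-pointwise f g k zero e j k≤j j< = ⊥-elim (ℕ.<⇒≱ j< (subst (_≤ j) (sym (ℕ.+-identityʳ k)) k≤j))
map-range-pointwise f g k (suc n) e j k≤j j< with k ≟ j
... | yes refl = List.∷-injectiveˡ e
... | no k≢j = map-range-pointwise f g (suc k) n (List.∷-injectiveʳ e) j
                 (ℕ.≤∧≢⇒< k≤j k≢j) (subst (j <_) (ℕ.+-suc k n) j<)

-- Blocks of a labelling of a list of segments.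

withLabel : ℕ → List (List ℕ × ℕ) → List (List ℕ × ℕ)
withLabel j = filter (λ p → proj₂ p ≟ j)

block-here : ∀ s ss l ls j → l ≡ j → block (s ∷ ss) (l ∷ ls) j ≡ s ∷ block ss ls j
block-here s ss l ls j l≡j = cong (map proj₁) (List.filter-accept (λ p → proj₂ p ≟ j) {x = s , l} l≡j)

block-skip : ∀ s ss l ls j → l ≢ j → block (s ∷ ss) (l ∷ ls) j ≡ block ss ls j
block-skip s ss l ls j l≢j = cong (map proj₁) (List.filter-reject (λ p → proj₂ p ≟ j) {x = s , l} l≢j)

-- A block is a sublist of the segment list, so it inherits properties of segments
-- and of pairs of segments; in particular blocks of chains are chains.
All-block : ∀ {P : List ℕ → Set} segs L j → All P segs → All P (block segs L j)
All-block [] L j _ = []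
All-block (s ∷ ss) [] j _ = []
All-block (s ∷ ss) (l ∷ ls) j (p ∷ ps) with l ≟ j
... | yes l≡j rewrite block-here s ss l ls j l≡j = p ∷ All-block ss ls j ps
... | no l≢j rewrite block-skip s ss l ls j l≢j = All-block ss ls j ps

AllPairs-block : ∀ {R : List ℕ → List ℕ → Set} segs L j → AllPairs R segs → AllPairs R (block segs L j)
AllPairs-block [] L j _ = []
AllPairs-block (s ∷ ss) [] j _ = []
AllPairs-block (s ∷ ss) (l ∷ ls) j (r ∷ rs) with l ≟ j
... | yes l≡j rewrite block-here s ss l ls j l≡j = All-block ss ls j r ∷ AllPairs-block ss ls j rs
... | no l≢j rewrite block-skip s ss l ls j l≢j = AllPairs-block ss ls j rs

Chain-block : ∀ segs L j → Chain segs → Chain (block segs L j)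
Chain-block segs L j (desc , led) = AllPairs-block segs L j desc , All-block segs L j led

sortDec-descending : ∀ S → AllPairs Descends S → sortDec S ≡ S
sortDec-descending [] _ = refl
sortDec-descending (s ∷ S) (desc ∷ descs) rewrite sortDec-descending S descs = insert-front S desc
  where
  insert-front : ∀ S → All (Descends s) S → insertDec s S ≡ s ∷ S
  insert-front [] _ = refl
  insert-front (t ∷ ts) (t<s ∷ _) rewrite <ᵇ-true t<s = refl

hatX-block : ∀ segs L j → AllPairs Descends segs → hatX segs L j ≡ concat (block segs L j)
hatX-block segs L j desc = cong concat (sortDec-descending (block segs L j) (AllPairs-block segs L j desc))

length-block : ∀ segs L j → length segs ≡ length L → length (block segs L j) ≡ count j L
length-block [] [] j _ = refl
length-block (s ∷ ss) (l ∷ ls) j e with l ≟ j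
... | yes l≡j rewrite block-here s ss l ls j l≡j | List.filter-accept (_≟ j) {x = l} {xs = ls} l≡j =
  cong suc (length-block ss ls j (ℕ.suc-injective e))
... | no l≢j rewrite block-skip s ss l ls j l≢j | List.filter-reject (_≟ j) {x = l} {xs = ls} l≢j =
  length-block ss ls j (ℕ.suc-injective e)

blocks-↭ : ∀ k r (Z : List (List ℕ × ℕ)) → All (λ p → k ≤ proj₂ p × proj₂ p < k + r) Z →
  concat (map (λ j → map proj₁ (withLabel j Z)) (range k r)) ↭ map proj₁ Z
blocks-↭ k zero [] _ = ↭-refl
blocks-↭ k zero (z ∷ Z) ((k≤ , <k+0) ∷ _) = ⊥-elim (ℕ.<⇒≱ <k+0 (subst (_≤ proj₂ z) (sym (ℕ.+-identityʳ k)) k≤))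
blocks-↭ k (suc r) Z bounds = begin
    map proj₁ (withLabel k Z) ++ concat (map (λ j → map proj₁ (withLabel j Z)) (range (suc k) r))
  ≡⟨ cong (λ rest → map proj₁ (withLabel k Z) ++ concat rest) (List.map-cong-local later-labels) ⟩
    map proj₁ (withLabel k Z) ++ concat (map (λ j → map proj₁ (withLabel j others)) (range (suc k) r))
  ↭⟨ ↭.++⁺ˡ (map proj₁ (withLabel k Z)) (blocks-↭ (suc k) r others others-bounds) ⟩
    map proj₁ (withLabel k Z) ++ map proj₁ others
  ≡⟨ List.map-++ proj₁ (withLabel k Z) others ⟨
    map proj₁ (withLabel k Z ++ others)
  ↭⟨ ↭.map⁺ proj₁ (partition-↭ (λ p → proj₂ p ≟ k) Z) ⟩
    map proj₁ Z ∎
  where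
  open ↭.PermutationReasoning
  others : List (List ℕ × ℕ)
  others = filter (¬? ∘ (λ p → proj₂ p ≟ k)) Z
  later-labels : All (λ j → map proj₁ (withLabel j Z) ≡ map proj₁ (withLabel j others)) (range (suc k) r)
  later-labels = All.map (λ (k<j , _) → cong (map proj₁) (sym (filter-filter-weaker (λ p → proj₂ p ≟ _)
                   (¬? ∘ (λ p → proj₂ p ≟ k)) (λ { refl → ℕ.>⇒≢ k<j }) Z))) (range-bounds (suc k) r)
  others-bounds : All (λ p → suc k ≤ proj₂ p × proj₂ p < suc k + r) others
  others-bounds = All.map (λ {p} ((k≤ , <k+r) , ≢k) →
                              ℕ.≤∧≢⇒< k≤ (≢k ∘ sym) , subst (proj₂ p <_) (ℕ.+-suc k r) <k+r)
                    (All-filter-¬ (λ p → proj₂ p ≟ k) bounds)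

hatX-nonempty : ∀ segs L j → Chain segs → length segs ≡ length L → 1 ≤ count j L → 1 ≤ length (hatX segs L j)
hatX-nonempty segs L j chain e used rewrite hatX-block segs L j (proj₁ chain) =
  nonempty (block segs L j) (All-block segs L j (proj₂ chain)) (subst (1 ≤_) (sym (length-block segs L j e)) used)
  where
  nonempty : ∀ B → All LedByMin B → 1 ≤ length B → 1 ≤ length (concat B)
  nonempty ((x ∷ t) ∷ B) _ _ = s≤s z≤n
  nonempty ([] ∷ B) (() ∷ _) _

-- The first segments of two such chains open the blocks of their labels; if the
-- labels differ, each first segment would lie strictly after the other one.
blocks-determine : ∀ r segs segs' L L' → length segs ≡ length L → length segs' ≡ length L' →
  AllPairs Descends segs → AllPairs Descends segs' → All (_< r) L → All (_< r) L' →
  (∀ j → j < r → block segs L j ≡ block segs' L' j) → segs ≡ segs' × L ≡ L'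
blocks-determine r [] [] [] [] _ _ _ _ _ _ _ = refl , refl
blocks-determine r [] (s' ∷ ss') [] (l' ∷ ls') _ _ _ _ _ (l'<r ∷ _) same
  with () ← trans (same l' l'<r) (block-here s' ss' l' ls' l' refl)
blocks-determine r (s ∷ ss) [] (l ∷ ls) [] _ _ _ _ (l<r ∷ _) _ same
  with () ← trans (sym (same l l<r)) (block-here s ss l ls l refl)
blocks-determine r (s ∷ ss) (s' ∷ ss') (l ∷ ls) (l' ∷ ls') e e' (d ∷ ds) (d' ∷ ds') (l<r ∷ ls<r) (l'<r ∷ ls'<r) same
  with l ≟ l'
... | no l≢l' = ⊥-elim (ℕ.<-asym (opens-later {s'} ss' ls' l d' s-in-second) (opens-later {s} ss ls l' d s'-in-first))
  where
  opens-later : ∀ {t t' X} ts ms j → All (Descends t) ts → block ts ms j ≡ t' ∷ X → Descends t t'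
  opens-later ts ms j desc e with All-block ts ms j desc
  ... | q rewrite e with q
  ... | p ∷ _ = p
  s-in-second : block ss' ls' l ≡ s ∷ block ss ls l
  s-in-second = trans (sym (block-skip s' ss' l' ls' l (l≢l' ∘ sym))) (trans (sym (same l l<r)) (block-here s ss l ls l refl))
  s'-in-first : block ss ls l' ≡ s' ∷ block ss' ls' l'
  s'-in-first = trans (sym (block-skip s ss l ls l' l≢l')) (trans (same l' l'<r) (block-here s' ss' l' ls' l' refl))
... | yes refl =
  let (ss≡ss' , ls≡ls') = blocks-determine r ss ss' ls ls' (ℕ.suc-injective e) (ℕ.suc-injective e') ds ds' ls<r ls'<r same-rest
  in cong₂ _∷_ (List.∷-injectiveˡ first-blocks) ss≡ss' , cong (l ∷_) ls≡ls'
  where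
  first-blocks : s ∷ block ss ls l ≡ s' ∷ block ss' ls' l
  first-blocks = trans (sym (block-here s ss l ls l refl)) (trans (same l l<r) (block-here s' ss' l ls' l refl))
  same-rest : ∀ j → j < r → block ss ls j ≡ block ss' ls' j
  same-rest j j<r with l ≟ j
  ... | yes refl = List.∷-injectiveʳ first-blocks
  ... | no l≢j = trans (sym (block-skip s ss l ls j l≢j)) (trans (same j j<r) (block-skip s' ss' l ls' j l≢j))

split : List ℕ → List ℕ → List (List ℕ)
split [] xs = []
split (k ∷ ks) xs = take k xs ∷ split ks (drop k xs)

split-correct : ∀ ks (xs : List ℕ) → sum ks ≡ length xs → concat (split ks xs) ≡ xs × map length (split ks xs) ≡ ks
split-correct [] [] _ = refl , refl
split-correct (k ∷ ks) xs e =
  let (concat-rest , lengths-rest) = split-correct ks (drop k xs) length-rest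
  in trans (cong (take k xs ++_) concat-rest) (List.take++drop≡id k xs) , cong₂ _∷_ length-first lengths-rest
  where
  k≤ : k ≤ length xs
  k≤ = subst (k ≤_) e (ℕ.m≤m+n k (sum ks))
  length-rest : sum ks ≡ length (drop k xs)
  length-rest = sym (trans (List.length-drop k xs) (trans (cong (_∸ k) (sym e)) (ℕ.m+n∸m≡n k (sum ks))))
  length-first : length (take k xs) ≡ k
  length-first = trans (List.length-take k xs) (ℕ.m≤n⇒m⊓n≡m k≤)

labelBlocks : ℕ → List (List (List ℕ)) → List (List ℕ × ℕ)
labelBlocks k [] = []
labelBlocks k (B ∷ Bs) = map (_, k) B ++ labelBlocks (suc k) Bs

labelBlocks-segments : ∀ k Bs → map proj₁ (labelBlocks k Bs) ≡ concat Bs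
labelBlocks-segments k [] = refl
labelBlocks-segments k (B ∷ Bs) = trans (List.map-++ proj₁ (map (_, k) B) (labelBlocks (suc k) Bs))
  (cong₂ _++_ (trans (sym (List.map-∘ B)) (List.map-id B)) (labelBlocks-segments (suc k) Bs))

labelBlocks-bounds : ∀ k Bs → All (λ p → k ≤ proj₂ p × proj₂ p < k + length Bs) (labelBlocks k Bs)
labelBlocks-bounds k [] = []
labelBlocks-bounds k (B ∷ Bs) = All.++⁺ (All.map⁺ (All.tabulate (λ _ → ℕ.≤-refl , ℕ.m<m+n k (s≤s z≤n))))
  (All.map (λ {p} (k<l , l<) → ℕ.<⇒≤ k<l , subst (proj₂ p <_) (sym (ℕ.+-suc k (length Bs))) l<)
           (labelBlocks-bounds (suc k) Bs))

withLabel-labelBlocks-first : ∀ k B Bs → withLabel k (labelBlocks k (B ∷ Bs)) ≡ map (_, k) B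
withLabel-labelBlocks-first k B Bs = begin
    withLabel k (map (_, k) B ++ labelBlocks (suc k) Bs)
  ≡⟨ List.filter-++ (λ p → proj₂ p ≟ k) (map (_, k) B) (labelBlocks (suc k) Bs) ⟩
    withLabel k (map (_, k) B) ++ withLabel k (labelBlocks (suc k) Bs)
  ≡⟨ cong₂ _++_ (List.filter-all (λ p → proj₂ p ≟ k) (All.map⁺ (All.tabulate (λ _ → refl))))
                (List.filter-none (λ p → proj₂ p ≟ k) (All.map (λ (k< , _) → ℕ.>⇒≢ k<) (labelBlocks-bounds (suc k) Bs))) ⟩
    map (_, k) B ++ []
  ≡⟨ List.++-identityʳ _ ⟩
    map (_, k) B ∎
  where open ≡-Reasoning

withLabel-labelBlocks-later : ∀ j k B Bs → j ≢ k → withLabel j (labelBlocks k (B ∷ Bs)) ≡ withLabel j (labelBlocks (suc k) Bs)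
withLabel-labelBlocks-later j k B Bs j≢k =
  trans (List.filter-++ (λ p → proj₂ p ≟ j) (map (_, k) B) (labelBlocks (suc k) Bs))
    (cong (_++ withLabel j (labelBlocks (suc k) Bs))
      (List.filter-none (λ p → proj₂ p ≟ j) (All.map⁺ {f = _, k} (All.tabulate {xs = B} (λ _ → j≢k ∘ sym)))))

blocks-labelBlocks : ∀ k Bs → map (λ j → map proj₁ (withLabel j (labelBlocks k Bs))) (range k (length Bs)) ≡ Bs
blocks-labelBlocks k [] = refl
blocks-labelBlocks k (B ∷ Bs) = cong₂ _∷_ first (trans later (blocks-labelBlocks (suc k) Bs))
  where
  first : map proj₁ (withLabel k (labelBlocks k (B ∷ Bs))) ≡ B
  first = trans (cong (map proj₁) (withLabel-labelBlocks-first k B Bs)) (trans (sym (List.map-∘ B)) (List.map-id B))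
  later : map (λ j → map proj₁ (withLabel j (labelBlocks k (B ∷ Bs)))) (range (suc k) (length Bs))
        ≡ map (λ j → map proj₁ (withLabel j (labelBlocks (suc k) Bs))) (range (suc k) (length Bs))
  later = List.map-cong-local (All.map (λ (k<j , _) → cong (map proj₁) (withLabel-labelBlocks-later _ k B Bs (ℕ.>⇒≢ k<j)))
                                       (range-bounds (suc k) (length Bs)))

count-withLabel : ∀ j (Z : List (List ℕ × ℕ)) → count j (map proj₂ Z) ≡ length (withLabel j Z)
count-withLabel j [] = refl
count-withLabel j (z ∷ Z) with proj₂ z ≟ j
... | yes l≡j = trans (cong length (List.filter-accept (_≟ j) {xs = map proj₂ Z} l≡j))
                  (trans (cong suc (count-withLabel j Z)) (cong length (sym (List.filter-accept (λ p → proj₂ p ≟ j) {xs = Z} l≡j))))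
... | no l≢j = trans (cong length (List.filter-reject (_≟ j) {xs = map proj₂ Z} l≢j))
                  (trans (count-withLabel j Z) (cong length (sym (List.filter-reject (λ p → proj₂ p ≟ j) {xs = Z} l≢j))))

module SortByKey {A : Set} (key : A → ℕ) where
  Above AtLeast : A → A → Set
  Above a b = key b < key a
  AtLeast a b = key b ≤ key a

  insert : A → List A → List A
  insert x [] = x ∷ []
  insert x (y ∷ ys) = if key y <ᵇ key x then x ∷ y ∷ ys else y ∷ insert x ys

  sort : List A → List A
  sort = foldr insert []

  insert-↭ : ∀ x xs → insert x xs ↭ x ∷ xs
  insert-↭ x [] = ↭-refl
  insert-↭ x (y ∷ ys) with key y <ᵇ key x
  ... | true = ↭-refl
  ... | false = ↭-trans (prep y (insert-↭ x ys)) (swap y x ↭-refl)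

  sort-↭ : ∀ xs → sort xs ↭ xs
  sort-↭ [] = ↭-refl
  sort-↭ (x ∷ xs) = ↭-trans (insert-↭ x (sort xs)) (prep x (sort-↭ xs))

  insert-sorted : ∀ x xs → AllPairs AtLeast xs → AllPairs AtLeast (insert x xs)
  insert-sorted x [] _ = [] ∷ []
  insert-sorted x (y ∷ ys) (y≥ ∷ sorted) with key y <ᵇ key x in eq
  ... | true = let y≤x = ℕ.<⇒≤ (<ᵇ-true⇒ eq)
               in (y≤x ∷ All.map (λ z≤y → ℕ.≤-trans z≤y y≤x) y≥) ∷ y≥ ∷ sorted
  ... | false = ↭.All-resp-↭ (↭-sym (insert-↭ x ys)) (<ᵇ-false⇒ eq ∷ y≥) ∷ insert-sorted x ys sorted

  sort-sorted : ∀ xs → AllPairs AtLeast (sort xs)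
  sort-sorted [] = []
  sort-sorted (x ∷ xs) = insert-sorted x (sort xs) (sort-sorted xs)

  strictly-sorted : ∀ {xs} → AllPairs AtLeast xs → AllPairs (λ a b → key a ≢ key b) xs → AllPairs Above xs
  strictly-sorted [] [] = []
  strictly-sorted (≥s ∷ sorted) (≢s ∷ distinct) = strict ≥s ≢s ∷ strictly-sorted sorted distinct
    where
    strict : ∀ {x ys} → All (AtLeast x) ys → All (λ y → key x ≢ key y) ys → All (Above x) ys
    strict [] [] = []
    strict (y≤x ∷ ≤s) (x≢y ∷ ≢s) = ℕ.≤∧≢⇒< y≤x (x≢y ∘ sym) ∷ strict ≤s ≢s

  descending-unique : ∀ {xs ys} → AllPairs Above xs → AllPairs Above ys → xs ↭ ys → xs ≡ ys
  descending-unique {[]} {[]} _ _ _ = refl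
  descending-unique {[]} {y ∷ ys} _ _ p = ⊥-elim (↭.¬x∷xs↭[] (↭-sym p))
  descending-unique {x ∷ xs} {[]} _ _ p = ⊥-elim (↭.¬x∷xs↭[] p)
  descending-unique {x ∷ xs} {y ∷ ys} (x> ∷ xs↓) (y> ∷ ys↓) p with same-first
    where
    same-first : x ≡ y
    same-first with ↭.∈-resp-↭ p (here refl) | ↭.∈-resp-↭ (↭-sym p) (here refl)
    ... | here x≡y | _ = x≡y
    ... | there _ | here y≡x = sym y≡x
    ... | there x∈ys | there y∈xs = ⊥-elim (ℕ.<-asym (All.lookup y> x∈ys) (All.lookup x> y∈xs))
  ... | refl = cong (x ∷_) (descending-unique xs↓ ys↓ (↭.drop-∷ p))

-- h maps the domain into Asc_n × S_n: τ rearranges the segments of π, and β is α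
-- with run multiplicities |X̂_j| instead of |X_j|.
module Forward {n : ℕ} {π α L : List ℕ} (dom : InDom n (π , α , L)) where
  segs : List (List ℕ)
  segs = LMin π

  R : List (ℕ × ℕ)
  R = RLE α

  r : ℕ
  r = length R

  chain : Chain segs
  chain = LMin-chain π

  length-L : length L ≡ length segs
  length-L = proj₁ (proj₂ (proj₂ (proj₂ dom)))

  π-perm : IsPerm n π
  π-perm = proj₁ dom

  asc-α : IsAsc α
  asc-α = proj₁ (proj₂ dom)

  osp : IsOSP (RLR α) L
  osp = proj₂ (proj₂ (proj₂ (proj₂ dom)))

  length-RLR : length (RLR α) ≡ r
  length-RLR = List.length-map proj₂ R

  labels<r : All (_< r) L
  labels<r = subst (λ m → All (_< m) L) length-RLR (proj₁ osp)

  counts : map (λ j → count j L) (upTo r) ≡ map proj₂ R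
  counts = subst (λ m → map (λ j → count j L) (upTo m) ≡ map proj₂ R) length-RLR (proj₂ osp)

  hats : map (hatX segs L) (upTo r) ≡ map (concat ∘ block segs L) (range 0 r)
  hats = trans (cong (map (hatX segs L)) (upTo-range r)) (List.map-cong (λ j → hatX-block segs L j (proj₁ chain)) (range 0 r))

  blocks-from-hats : map LMin (map (hatX segs L) (upTo r)) ≡ map (block segs L) (range 0 r)
  blocks-from-hats = begin
    map LMin (map (hatX segs L) (upTo r))               ≡⟨ cong (map LMin) hats ⟩
    map LMin (map (concat ∘ block segs L) (range 0 r))  ≡⟨ List.map-∘ (range 0 r) ⟨
    map (LMin ∘ concat ∘ block segs L) (range 0 r)      ≡⟨ List.map-cong (λ j → LMin-concat _ (Chain-block segs L j chain)) (range 0 r) ⟩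
    map (block segs L) (range 0 r)                      ∎
    where open ≡-Reasoning

  τ : List ℕ
  τ = proj₂ (h (π , α , L))

  τ↭π : τ ↭ π
  τ↭π = begin
    τ                                                  ≡⟨ cong concat hats ⟩
    concat (map (concat ∘ block segs L) (range 0 r))   ≡⟨ cong concat (List.map-∘ (range 0 r)) ⟩
    concat (map concat (map (block segs L) (range 0 r))) ≡⟨ List.concat-concat (map (block segs L) (range 0 r)) ⟩
    concat (concat (map (block segs L) (range 0 r)))   ↭⟨ concat-↭ (blocks-↭ 0 r (zip segs L) bounds) ⟩
    concat (map proj₁ (zip segs L))                    ≡⟨ cong concat (map-proj₁-zip segs L (sym length-L)) ⟩
    concat segs                                        ≡⟨ concat-LMin π ⟩
    π                                                  ∎
    where
    open ↭.PermutationReasoning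
    bounds : All (λ p → 0 ≤ proj₂ p × proj₂ p < r) (zip segs L)
    bounds = All-zip₂ segs L (All.map (z≤n ,_) labels<r)

  ℓs : List ℕ
  ℓs = map (length ∘ hatX segs L) (upTo r)

  length-ℓs : length ℓs ≡ length R
  length-ℓs = trans (List.length-map _ (upTo r)) (List.length-upTo r)

  ℓs-positive : All (1 ≤_) ℓs
  ℓs-positive = All.map⁺ (All.map (hatX-nonempty segs L _ chain (sym length-L))
    (All.map⁻ (subst (All (1 ≤_)) (sym counts) (All.map⁺ (Runs⇒positive R (Runs-RLE α))))))

  β-runs : proj₁ (h (π , α , L)) ≡ expand (reRun R ℓs)
  β-runs = concat-replicate-expand R (upTo r) (length ∘ hatX segs L)

  length-τ : length τ ≡ n
  length-τ = trans (↭.↭-length τ↭π) (trans (↭.↭-length π-perm) (List.length-applyUpTo suc n))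

  length-β : length (expand (reRun R ℓs)) ≡ n
  length-β = begin
    length (expand (reRun R ℓs))         ≡⟨ length-expand (reRun R ℓs) ⟩
    sum (map proj₂ (reRun R ℓs))         ≡⟨ cong sum (mults-reRun R ℓs length-ℓs) ⟩
    sum ℓs                               ≡⟨ cong sum (List.map-∘ (upTo r)) ⟩
    sum (map length (map (hatX segs L) (upTo r))) ≡⟨ length-concat (map (hatX segs L) (upTo r)) ⟨
    length τ                             ≡⟨ length-τ ⟩
    n                                    ∎
    where open ≡-Reasoning

  inCod : InCod n (h (π , α , L))
  inCod = subst IsAsc (sym β-runs) asc-β , trans (cong length β-runs) length-β , ↭-trans τ↭π π-perm
    where
    asc-β : IsAsc (expand (reRun R ℓs))
    asc-β = ascent-reRun R ℓs (Runs-RLE α) ℓs-positive length-ℓs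
              (subst IsAsc (sym (expand-RLE α)) asc-α)

-- h is injective: the runs of β give the run values of α and the lengths |X̂_j|,
-- which cut τ into the words X̂_j; these give back the blocks, the blocks give back
-- LMin π and L, and the block sizes are the run multiplicities of α.
module Injective {n : ℕ} {π α L π' α' L' : List ℕ} (dom : InDom n (π , α , L)) (dom' : InDom n (π' , α' , L'))
                 (same : h (π , α , L) ≡ h (π' , α' , L')) where
  module X = Forward dom
  module Y = Forward dom'

  same-runs : reRun X.R X.ℓs ≡ reRun Y.R Y.ℓs
  same-runs = begin
    reRun X.R X.ℓs                 ≡⟨ RLE-expand _ (Runs-reRun X.R X.ℓs (Runs-RLE α) X.ℓs-positive) ⟨
    RLE (expand (reRun X.R X.ℓs))  ≡⟨ cong RLE (trans (sym X.β-runs) (trans (cong proj₁ same) Y.β-runs)) ⟩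
    RLE (expand (reRun Y.R Y.ℓs))  ≡⟨ RLE-expand _ (Runs-reRun Y.R Y.ℓs (Runs-RLE α') Y.ℓs-positive) ⟩
    reRun Y.R Y.ℓs                 ∎
    where open ≡-Reasoning

  same-values : map proj₁ X.R ≡ map proj₁ Y.R
  same-values = trans (sym (values-reRun X.R X.ℓs X.length-ℓs))
                  (trans (cong (map proj₁) same-runs) (values-reRun Y.R Y.ℓs Y.length-ℓs))

  same-ℓs : X.ℓs ≡ Y.ℓs
  same-ℓs = trans (sym (mults-reRun X.R X.ℓs X.length-ℓs))
              (trans (cong (map proj₂) same-runs) (mults-reRun Y.R Y.ℓs Y.length-ℓs))

  same-r : X.r ≡ Y.r
  same-r = trans (sym (List.length-map proj₁ X.R)) (trans (cong length same-values) (List.length-map proj₁ Y.R))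

  same-hats : map (hatX X.segs L) (upTo X.r) ≡ map (hatX Y.segs L') (upTo Y.r)
  same-hats = concat-injective _ _ (trans (sym (List.map-∘ (upTo X.r))) (trans same-ℓs (List.map-∘ (upTo Y.r))))
                (cong proj₂ same)

  same-blocks : map (block X.segs L) (range 0 X.r) ≡ map (block Y.segs L') (range 0 X.r)
  same-blocks = begin
    map (block X.segs L) (range 0 X.r)       ≡⟨ X.blocks-from-hats ⟨
    map LMin (map (hatX X.segs L) (upTo X.r)) ≡⟨ cong (map LMin) same-hats ⟩
    map LMin (map (hatX Y.segs L') (upTo Y.r)) ≡⟨ Y.blocks-from-hats ⟩
    map (block Y.segs L') (range 0 Y.r)      ≡⟨ cong (λ m → map (block Y.segs L') (range 0 m)) same-r ⟨
    map (block Y.segs L') (range 0 X.r)      ∎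
    where open ≡-Reasoning

  same-segs-labels : X.segs ≡ Y.segs × L ≡ L'
  same-segs-labels =
    blocks-determine X.r X.segs Y.segs L L' (sym X.length-L) (sym Y.length-L) (proj₁ X.chain) (proj₁ Y.chain)
      X.labels<r (subst (λ m → All (_< m) L') (sym same-r) Y.labels<r)
      (λ j j<r → map-range-pointwise (block X.segs L) (block Y.segs L') 0 X.r same-blocks j z≤n j<r)

  same-RLE : X.R ≡ Y.R
  same-RLE = unzip-injective X.R Y.R same-values (begin
    map proj₂ X.R                          ≡⟨ X.counts ⟨
    map (λ j → count j L) (upTo X.r)       ≡⟨ cong₂ (λ L m → map (λ j → count j L) (upTo m)) (proj₂ same-segs-labels) same-r ⟩
    map (λ j → count j L') (upTo Y.r)      ≡⟨ Y.counts ⟩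
    map proj₂ Y.R                          ∎)
    where open ≡-Reasoning

  injective : (π , α , L) ≡ (π' , α' , L')
  injective = cong₂ _,_ same-π (cong₂ _,_ same-α (proj₂ same-segs-labels))
    where
    same-π : π ≡ π'
    same-π = trans (sym (concat-LMin π)) (trans (cong concat (proj₁ same-segs-labels)) (concat-LMin π'))
    same-α : α ≡ α'
    same-α = trans (sym (expand-RLE α)) (trans (cong expand same-RLE) (expand-RLE α'))

open SortByKey {List ℕ × ℕ} (headOr0 ∘ proj₁) using (sort; sort-↭; sort-sorted; strictly-sorted; descending-unique)

withLabel-labelBlocks-descending : ∀ j k Bs → All (AllPairs Descends) Bs →
  AllPairs (λ p q → Descends (proj₁ p) (proj₁ q)) (withLabel j (labelBlocks k Bs))
withLabel-labelBlocks-descending j k [] _ = []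
withLabel-labelBlocks-descending j k (B ∷ Bs) (B↓ ∷ Bs↓) with j ≟ k
... | yes refl rewrite withLabel-labelBlocks-first j B Bs = AllPairs.map⁺ B↓
... | no j≢k rewrite withLabel-labelBlocks-later j k B Bs j≢k = withLabel-labelBlocks-descending j (suc k) Bs Bs↓

-- h is onto: cut τ into words with the run lengths of β, cut each word into its
-- segments, label the segments of the j-th word by j and sort all labelled segments
-- by decreasing first letter; this gives LMin π and L, while α keeps the run values
-- of β with the numbers of segments of the words as multiplicities.
module Surjective {n : ℕ} {β τ : List ℕ} (cod : InCod n (β , τ)) where
  R : List (ℕ × ℕ)
  R = RLE β

  ℓs : List ℕ
  ℓs = map proj₂ R

  sum-ℓs : sum ℓs ≡ length τ
  sum-ℓs = begin
    sum ℓs              ≡⟨ length-expand R ⟨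
    length (expand R)   ≡⟨ cong length (expand-RLE β) ⟩
    length β            ≡⟨ proj₁ (proj₂ cod) ⟩
    n                   ≡⟨ List.length-applyUpTo suc n ⟨
    length (applyUpTo suc n) ≡⟨ ↭.↭-length (proj₂ (proj₂ cod)) ⟨
    length τ            ∎
    where open ≡-Reasoning

  words : List (List ℕ)
  words = split ℓs τ

  concat-words : concat words ≡ τ
  concat-words = proj₁ (split-correct ℓs τ sum-ℓs)

  Bs : List (List (List ℕ))
  Bs = map LMin words

  concat-Bs : map concat Bs ≡ words
  concat-Bs = trans (sym (List.map-∘ words)) (trans (List.map-cong concat-LMin words) (List.map-id words))

  concat²-Bs : concat (concat Bs) ≡ τ
  concat²-Bs = trans (sym (List.concat-concat Bs)) (trans (cong concat concat-Bs) concat-words)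

  labelled : List (List ℕ × ℕ)
  labelled = labelBlocks 0 Bs

  sorted : List (List ℕ × ℕ)
  sorted = sort labelled

  segs : List (List ℕ)
  segs = map proj₁ sorted

  L : List ℕ
  L = map proj₂ sorted

  π : List ℕ
  π = concat segs

  ms : List ℕ
  ms = map length Bs

  α : List ℕ
  α = expand (reRun R ms)

  τ-distinct : AllPairs _≢_ τ
  τ-distinct = AllPairs-resp-↭ (_∘ sym) (↭-sym (proj₂ (proj₂ cod)))
    (subst (AllPairs _≢_) (List.map-applyUpTo id suc n) (Unique.map⁺ ℕ.suc-injective (Unique.upTo⁺ n)))

  led-Bs : All LedByMin (concat Bs)
  led-Bs = All.concat⁺ (All.map⁺ (All.tabulate {xs = words} (λ {w} _ → proj₂ (LMin-chain w))))

  descending-Bs : All (AllPairs Descends) Bs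
  descending-Bs = All.map⁺ (All.tabulate {xs = words} (λ {w} _ → proj₁ (LMin-chain w)))

  sorted-descending : AllPairs (λ p q → Descends (proj₁ p) (proj₁ q)) sorted
  sorted-descending = strictly-sorted (sort-sorted labelled)
    (AllPairs-resp-↭ (_∘ sym) (↭-sym (sort-↭ labelled)) (AllPairs.map⁻ (subst (AllPairs (λ s t → headOr0 s ≢ headOr0 t))
      (sym (labelBlocks-segments 0 Bs)) (heads-distinct (concat Bs) (subst (AllPairs _≢_) (sym concat²-Bs) τ-distinct) led-Bs))))

  chain : Chain segs
  chain = AllPairs.map⁺ sorted-descending ,
          All.map⁺ (↭.All-resp-↭ (↭-sym (sort-↭ labelled))
                      (All.map⁻ (subst (All LedByMin) (sym (labelBlocks-segments 0 Bs)) led-Bs)))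

  LMin-π : LMin π ≡ segs
  LMin-π = LMin-concat segs chain

  π-perm : IsPerm n π
  π-perm = begin
    concat (map proj₁ sorted)    ↭⟨ concat-↭ (↭.map⁺ proj₁ (sort-↭ labelled)) ⟩
    concat (map proj₁ labelled)  ≡⟨ cong concat (labelBlocks-segments 0 Bs) ⟩
    concat (concat Bs)           ≡⟨ concat²-Bs ⟩
    τ                            ↭⟨ proj₂ (proj₂ cod) ⟩
    applyUpTo suc n              ∎
    where open ↭.PermutationReasoning

  ms-positive : All (1 ≤_) ms
  ms-positive = All.map⁺ (All.map⁺ (All.map (λ {w} → LMin-nonempty w)
    (All.map⁻ (subst (All (1 ≤_)) (sym (proj₂ (split-correct ℓs τ sum-ℓs))) (All.map⁺ (Runs⇒positive R (Runs-RLE β)))))))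

  length-ms : length ms ≡ length R
  length-ms = begin
    length ms               ≡⟨ List.length-map length Bs ⟩
    length Bs               ≡⟨ List.length-map LMin words ⟩
    length words            ≡⟨ List.length-map length words ⟨
    length (map length words) ≡⟨ cong length (proj₂ (split-correct ℓs τ sum-ℓs)) ⟩
    length ℓs               ≡⟨ List.length-map proj₂ R ⟩
    length R                ∎
    where open ≡-Reasoning

  RLE-α : RLE α ≡ reRun R ms
  RLE-α = RLE-expand (reRun R ms) (Runs-reRun R ms (Runs-RLE β) ms-positive)

  RLR-α : RLR α ≡ ms
  RLR-α = trans (cong (map proj₂) RLE-α) (mults-reRun R ms length-ms)

  asc-α : IsAsc α
  asc-α = ascent-reRun R ms (Runs-RLE β) ms-positive length-ms (subst IsAsc (sym (expand-RLE β)) (proj₁ cod))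

  length-sorted : length sorted ≡ length α
  length-sorted = begin
    length sorted                 ≡⟨ ↭.↭-length (sort-↭ labelled) ⟩
    length labelled               ≡⟨ List.length-map proj₁ labelled ⟨
    length (map proj₁ labelled)   ≡⟨ cong length (labelBlocks-segments 0 Bs) ⟩
    length (concat Bs)            ≡⟨ length-concat Bs ⟩
    sum ms                        ≡⟨ cong sum (mults-reRun R ms length-ms) ⟨
    sum (map proj₂ (reRun R ms))  ≡⟨ length-expand (reRun R ms) ⟨
    length α                      ∎
    where open ≡-Reasoning

  length-segs : length segs ≡ length sorted
  length-segs = List.length-map proj₁ sorted

  -- Sorting keeps each label class in place, so block j of the new labelling is the
  -- j-th given block.
  block-segs : ∀ j → block segs L j ≡ map proj₁ (withLabel j labelled)
  block-segs j = trans (cong (map proj₁ ∘ withLabel j) (zip-unzip sorted)) (cong (map proj₁)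
    (descending-unique (AllPairs.filter⁺ (λ p → proj₂ p ≟ j) sorted-descending)
      (withLabel-labelBlocks-descending j 0 Bs descending-Bs) (↭.filter-↭ (λ p → proj₂ p ≟ j) (sort-↭ labelled))))

  blocks-segs : map (block segs L) (range 0 (length Bs)) ≡ Bs
  blocks-segs = trans (List.map-cong block-segs (range 0 (length Bs))) (blocks-labelBlocks 0 Bs)

  length-Bs : length ms ≡ length Bs
  length-Bs = List.length-map length Bs

  osp : IsOSP ms L
  osp = labels< , counts
    where
    labels< : All (_< length ms) L
    labels< = All.map⁺ (All.map (λ (_ , l<) → subst (_ <_) (sym length-Bs) l<)
                (↭.All-resp-↭ (↭-sym (sort-↭ labelled)) (labelBlocks-bounds 0 Bs)))
    counts : map (λ j → count j L) (upTo (length ms)) ≡ ms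
    counts = begin
      map (λ j → count j L) (upTo (length ms))              ≡⟨ cong (map (λ j → count j L)) (trans (upTo-range _) (cong (range 0) length-Bs)) ⟩
      map (λ j → count j L) (range 0 (length Bs))           ≡⟨ List.map-cong count-block (range 0 (length Bs)) ⟩
      map (length ∘ block segs L) (range 0 (length Bs))     ≡⟨ List.map-∘ (range 0 (length Bs)) ⟩
      map length (map (block segs L) (range 0 (length Bs))) ≡⟨ cong (map length) blocks-segs ⟩
      ms                                                    ∎
      where
      open ≡-Reasoning
      count-block : ∀ j → count j L ≡ length (block segs L j)
      count-block j = sym (length-block segs L j (trans length-segs (sym (List.length-map proj₂ sorted))))

  dom : InDom n (π , α , L)
  dom = π-perm , asc-α , trans (sym length-sorted) (trans (sym length-segs) (cong length (sym LMin-π))) ,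
        trans (List.length-map proj₂ sorted) (trans (sym length-segs) (cong length (sym LMin-π))) ,
        subst (λ ms' → IsOSP ms' L) (sym RLR-α) osp

  hats : map (hatX (LMin π) L) (upTo (length (RLE α))) ≡ words
  hats = begin
    map (hatX (LMin π) L) (upTo (length (RLE α)))      ≡⟨ cong₂ (λ S m → map (hatX S L) (upTo m)) LMin-π number-of-runs ⟩
    map (hatX segs L) (upTo (length Bs))               ≡⟨ cong (map (hatX segs L)) (upTo-range (length Bs)) ⟩
    map (hatX segs L) (range 0 (length Bs))            ≡⟨ List.map-cong (λ j → hatX-block segs L j (proj₁ chain)) (range 0 (length Bs)) ⟩
    map (concat ∘ block segs L) (range 0 (length Bs))  ≡⟨ List.map-∘ (range 0 (length Bs)) ⟩
    map concat (map (block segs L) (range 0 (length Bs))) ≡⟨ cong (map concat) blocks-segs ⟩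
    map concat Bs                                      ≡⟨ concat-Bs ⟩
    words                                              ∎
    where
    open ≡-Reasoning
    number-of-runs : length (RLE α) ≡ length Bs
    number-of-runs = trans (sym (List.length-map proj₂ (RLE α))) (trans (cong length RLR-α) length-Bs)

  preimage : Σ (List ℕ × List ℕ × List ℕ) (λ x → InDom n x × h x ≡ (β , τ))
  preimage = (π , α , L) , dom , cong₂ _,_ β-part (trans (cong concat hats) concat-words)
    where
    open ≡-Reasoning
    r : ℕ
    r = length (RLE α)
    β-part : proj₁ (h (π , α , L)) ≡ β
    β-part = begin
      proj₁ (h (π , α , L))                                              ≡⟨ concat-replicate-expand (RLE α) (upTo r) (length ∘ hatX (LMin π) L) ⟩
      expand (reRun (RLE α) (map (length ∘ hatX (LMin π) L) (upTo r)))   ≡⟨ cong₂ (λ vs ls → expand (zip vs ls)) values lengths ⟩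
      expand (zip (map proj₁ R) (map proj₂ R))                           ≡⟨ cong expand (zip-unzip R) ⟩
      expand R                                                           ≡⟨ expand-RLE β ⟩
      β                                                                  ∎
      where
      values : map proj₁ (RLE α) ≡ map proj₁ R
      values = trans (cong (map proj₁) RLE-α) (values-reRun R ms length-ms)
      lengths : map (length ∘ hatX (LMin π) L) (upTo r) ≡ map proj₂ R
      lengths = trans (List.map-∘ (upTo r)) (trans (cong (map length) hats) (proj₂ (split-correct ℓs τ sum-ℓs)))

theorem21 : (n : ℕ) → 1 ≤ n →
    ((x : List ℕ × List ℕ × List ℕ) → InDom n x → InCod n (h x)) ×
    ((x y : List ℕ × List ℕ × List ℕ) → InDom n x → InDom n y → h x ≡ h y → x ≡ y) ×
    ((z : List ℕ × List ℕ) → InCod n z → Σ (List ℕ × List ℕ × List ℕ) (λ x → InDom n x × h x ≡ z))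
theorem21 n _ =
  (λ _ dom → Forward.inCod dom) ,
  (λ _ _ dom dom' same → Injective.injective dom dom' same) ,
  (λ _ cod → Surjective.preimage cod)
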